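{- Let $M=(\Gamma,\Sigma,P,\delta)$ be a linear bounded deterministic Turing machine, let $x\in\Sigma^*$ be an input with $|x|=n$, and let $Sys_M$ be the linear interaction system associated with $M$ and $x$ (constructed as described in the context). Then $M$ accepts $x$ (i.e. $M$ started on $x$ halts in state $p^Y$) if and only if some global state $q=(q_0,\dots,q_{n+1})$ is reachable in $Sys_M$ such that $q_i=(p^Y,\gamma)$ for some $i\in\{0,\dots,n+1\}$ and some $\gamma\in\Gamma$.
   Context: Interaction systems. An interaction model is $IM=(K,\{A_i\}_{i\in K},Int)$ where $K$ is a finite set of components, $\{A_i\}_{i\in K}$ are pairwise disjoint finite sets of ports, and $Int$ is a set of interactions, each interaction $\alpha$ being a nonempty subset of $\bigcup_{i\in K}A_i$ with $|\alpha\cap A_i|\le 1$ for all $i$, such that every port lies in some interaction. An interaction system is $Sys=(IM,\{T_i\}_{i\in K})$ where $T_i=(Q_i,A_i,\to_i,q_i^0)$ is a labeled transition system (finite state set $Q_i$, transition relation $\to_i\subseteq Q_i\times A_i\times Q_i$, initial state $q_i^0$). Its global behavior is the transition system with states $Q=\prod_{i\in K}Q_i$, initial state $q^0=(q_i^0)_{i\in K}$, and $q\xrightarrow{\alpha}q'$ for $\alpha\in Int$ iff for every $i\in K$: $q_i\xrightarrow{a_i}_i q_i'$ if $\alpha\cap A_i=\{a_i\}$, and $q_i=q_i'$ if $\alpha\cap A_i=\emptyset$. A global state is reachable if there is a path from $q^0$ to it. The interaction graph has vertex set $K$ and an edge $\{i,j\}$ ($i\ne j$) iff some interaction contains ports of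 both $i$ and $j$; the system is linear if this graph is a path (connected, two vertices of degree 1, all others of degree 2). Turing machines. A DTM is $M=(\Gamma,\Sigma,P,\delta)$ with finite tape alphabet $\Gamma$, input alphabet $\Sigma\subseteq\Gamma$, blank symbol $b\in\Gamma\setminus\Sigma$, finite state set $P$ containing an initial state $p^0$ and halting states $p^Y,p^N$, and transition function $\delta:(P\setminus\{p^Y,p^N\})\times\Gamma\to P\times\Gamma\times\{ -1,+1\}$ (new state, written symbol, head move). The tape is two-way infinite with cells indexed by integers; on input $x$ of length $n$, $x^i$ (the $i$-th letter) is written in cell $i$ for $1\le i\le n$, all other cells contain $b$, the machine starts in $p^0$ with the head on cell $1$. $M$ is linear bounded if on inputs of length $n$ the head never leaves cells $0,\dots,n+1$; configurations are written $(p;\gamma_0,\dots,\underline{\gamma_i},\dots,\gamma_{n+1})$. Construction of $Sys_M$. Components $K=\{0,1,\dots,n+1\}$. For $1\le i\le n$: $A_i=\{(p,\gamma)_i^1,(p,\gamma)_i^2 : p\in P\setminus\{p^Y,p^N\},\gamma\in\Gamma\}$. $A_0=\{(p,\gamma)_0^1 : p\in P\setminus\{p^Y,p^N\},\gamma\in\Gamma,\ \delta(p,\gamma)\text{ does not have head move }-1\}\cup\{(p,\gamma)_0^2 : p\in P\setminus\{p^Y,p^N\},\gamma\in\Gamma,\ \delta(p,\gamma)\text{ does not have head move }+1\}$; $A_{n+1}=\{(p,\gamma)_{n+1}^1 : \delta(p,\gamma)\text{ does not have head move }+1\}\cup\{(p,\gamma)_{n+1}^2 : \delta(p,\gamma)\text{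 does not have head move }-1\}$ (again $p\in P\setminus\{p^Y,p^N\},\gamma\in\Gamma$). Interactions: $Int=\{\{(p,\gamma)_i^1,(p,\gamma)_{i+T}^2\} : \delta(p,\gamma)=(p',\gamma',T)\text{ for some }p',\gamma',\ 0\le i,\ i+T\le n+1,\ i\le n+1\}$. For each $i\in K$, $Q_i=\{(p,\gamma): p\in P\cup\{s\},\gamma\in\Gamma\}$ where $s\notin P$ is an auxiliary symbol; initial states $q_0^0=(s,b)$, $q_1^0=(p^0,x^1)$, $q_i^0=(s,x^i)$ for $2\le i\le n$, $q_{n+1}^0=(s,b)$. The transitions $\to_i$ are exactly: (a) $(p,\gamma)\xrightarrow{(p,\gamma)_i^1}_i(s,\gamma')$ whenever $(p,\gamma)_i^1\in A_i$ and $\delta(p,\gamma)=(p',\gamma',T)$ for some $p',T$; (b) $(s,\tilde\gamma)\xrightarrow{(p,\gamma)_i^2}_i(p',\tilde\gamma)$ for all $\tilde\gamma\in\Gamma$, whenever $(p,\gamma)_i^2\in A_i$ and $\delta(p,\gamma)=(p',\gamma',T)$ for some $\gamma',T$. -}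

module Defs where

open import Data.Nat using (ℕ; zero; suc; _<?_)
open import Data.Integer as ℤ using (ℤ; +_; -[1+_])
open import Data.Fin using (Fin; toℕ; fromℕ<)
open import Data.Fin.Subset using (Subset; _∈_; _∉_)
open import Data.Maybe using (Maybe; just; nothing)
open import Data.Product using (Σ; ∃; _×_; _,_; proj₁; proj₂)
open import Data.Sum using (_⊎_)
open import Data.List using (List; _∷_; [])
open import Data.List.Membership.Propositional using () renaming (_∈_ to _∈ˡ_)
open import Data.Vec using (Vec; lookup)
open import Relation.Binary.PropositionalEquality using (_≡_; _≢_)
open import Relation.Binary.Construct.Closure.ReflexiveTransitive using (Star)
open import Relation.Nullary using (¬_; yes; no)

-- Ports are drawn from a type Port; port a belongs to component comp a
-- and is an actual port (a ∈ A_(comp a)) iff IsPort a.  An interaction is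
-- a finite set of ports, represented as a list; Int α says α ∈ Int.

record InteractionSystem : Set₁ where
  field
    K      : Set
    Port   : Set
    comp   : Port → K
    IsPort : Port → Set
    Int    : List Port → Set
    Q      : K → Set
    init   : (i : K) → Q i
    trans  : (i : K) → Q i → Port → Q i → Set

module _ (S : InteractionSystem) where
  open InteractionSystem S

  GlobalState : Set
  GlobalState = (i : K) → Q i

  GlobalStep : GlobalState → List Port → GlobalState → Set
  GlobalStep q α q' =
    Int α ×
    ((i : K) →
       (Σ Port λ a → a ∈ˡ α × comp a ≡ i × trans i (q i) a (q' i))
     ⊎ ((∀ a → a ∈ˡ α → comp a ≢ i) × q i ≡ q' i))

  GlobalStep' : GlobalState → GlobalState → Set
  GlobalStep' q q' = Σ (List Port) λ α → GlobalStep q α q'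

  Reachable : GlobalState → Set
  Reachable q = Star GlobalStep' init q

data Move : Set where
  left  : Move
  right : Move

moveℤ : Move → ℤ
moveℤ left  = -[1+ 0 ]
moveℤ right = + 1

-- Γ = Fin nΓ, P = Fin nP.  δ is given as a total function on P × Γ; its
-- values on the halting states p^Y, p^N are never used.
record DTM : Set where
  field
    nΓ nP    : ℕ
    Sig      : Subset nΓ
    blank    : Fin nΓ
    blank∉Sig : blank ∉ Sig
    p0 pY pN : Fin nP
    pY≢pN    : pY ≢ pN
    δ        : Fin nP → Fin nΓ → Fin nP × Fin nΓ × Move

module _ (M : DTM) where
  open DTM M

  Halting : Fin nP → Set
  Halting p = p ≡ pY ⊎ p ≡ pN

  δstate : Fin nP → Fin nΓ → Fin nP
  δstate p γ = proj₁ (δ p γ)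

  δwrite : Fin nP → Fin nΓ → Fin nΓ
  δwrite p γ = proj₁ (proj₂ (δ p γ))

  δmove : Fin nP → Fin nΓ → Move
  δmove p γ = proj₂ (proj₂ (δ p γ))

  record Config : Set where
    constructor config
    field
      state : Fin nP
      tape  : ℤ → Fin nΓ
      head  : ℤ
  open Config public

  updateTape : (ℤ → Fin nΓ) → ℤ → Fin nΓ → ℤ → Fin nΓ
  updateTape t h γ k with k ℤ.≟ h
  ... | yes _ = γ
  ... | no  _ = t k

  next : Config → Config
  next c = config (δstate (state c) (tape c (head c)))
                  (updateTape (tape c) (head c) (δwrite (state c) (tape c (head c))))
                  (head c ℤ.+ moveℤ (δmove (state c) (tape c (head c))))

  TMStep : Config → Config → Set
  TMStep c c' = ¬ Halting (state c) × c' ≡ next c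

  -- input x^1 … x^n in cells 1 … n, blank elsewhere
  initTape : ∀ {n} → Vec (Fin nΓ) n → ℤ → Fin nΓ
  initTape {n} x (+ suc k) with k <? n
  ... | yes k<n = lookup x (fromℕ< k<n)
  ... | no  _   = blank
  initTape x _ = blank

  initConfig : ∀ {n} → Vec (Fin nΓ) n → Config
  initConfig x = config p0 (initTape x) (+ 1)

  IsInput : ∀ {n} → Vec (Fin nΓ) n → Set
  IsInput x = ∀ k → lookup x k ∈ Sig

  Accepts : ∀ {n} → Vec (Fin nΓ) n → Set
  Accepts x = Σ Config λ c → Star TMStep (initConfig x) c × state c ≡ pY

  LinearBounded : Set
  LinearBounded = ∀ n (x : Vec (Fin nΓ) n) → IsInput x →
    ∀ c → Star TMStep (initConfig x) c →
    (+ 0 ℤ.≤ head c) × (head c ℤ.≤ + suc n)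

  data Sup : Set where
    one two : Sup

  module _ {n : ℕ} (x : Vec (Fin nΓ) n) where

    Comp : Set
    Comp = Fin (suc (suc n))

    record RawPort : Set where
      constructor port
      field
        pcomp : Comp
        pst   : Fin nP
        psym  : Fin nΓ
        psup  : Sup

    Bound0 : Sup → Move → Set
    Bound0 one T = T ≢ left
    Bound0 two T = T ≢ right

    BoundN : Sup → Move → Set
    BoundN one T = T ≢ right
    BoundN two T = T ≢ left

    InA : RawPort → Set
    InA (port i p γ k) =
      ¬ Halting p ×
      (toℕ i ≡ 0 → Bound0 k (δmove p γ)) ×
      (toℕ i ≡ suc n → BoundN k (δmove p γ))

    Adj : Move → Comp → Comp → Set
    Adj right i j = suc (toℕ i) ≡ toℕ j
    Adj left  i j = toℕ i ≡ suc (toℕ j)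

    IntM : List RawPort → Set
    IntM α = Σ (Fin nP) λ p → Σ (Fin nΓ) λ γ → Σ Comp λ i → Σ Comp λ j →
      ¬ Halting p × Adj (δmove p γ) i j ×
      α ≡ port i p γ one ∷ port j p γ two ∷ []

    -- local states (p,γ) with p ∈ P ∪ {s}; nothing encodes s
    LState : Set
    LState = Maybe (Fin nP) × Fin nΓ

    initCtl : ℕ → Maybe (Fin nP)
    initCtl 1 = just p0
    initCtl _ = nothing

    initM : Comp → LState
    initM i = initCtl (toℕ i) , initTape x (+ toℕ i)

    data LTrans (i : Comp) : LState → RawPort → LState → Set where
      tr1 : ∀ {p γ} → InA (port i p γ one) →
            LTrans i (just p , γ) (port i p γ one) (nothing , δwrite p γ)
      tr2 : ∀ {p γ γ~} → InA (port i p γ two) →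
            LTrans i (nothing , γ~) (port i p γ two) (just (δstate p γ) , γ~)

    SysM : InteractionSystem
    SysM = record
      { K      = Comp
      ; Port   = RawPort
      ; comp   = RawPort.pcomp
      ; IsPort = InA
      ; Int    = IntM
      ; Q      = λ _ → LState
      ; init   = initM
      ; trans  = LTrans
      }

-- The interaction system keeps one cell of the tape per component, and the
-- component under the head additionally holds the control state.  A machine
-- step that moves the head from cell i to cell i + T is mirrored by the unique
-- interaction {(p,γ)¹ᵢ , (p,γ)²ᵢ₊ₜ}: cell i writes and releases control, cell
-- i + T takes over the new state.  Because local transitions are deterministic
-- given their port, the encoding of configurations is a bisimulation between
-- the run of M and the reachable part of Sys_M, and a component holds p^Y
-- exactly when the machine has halted accepting.  Linear boundedness is what
-- keeps the head on the components 0, …, n+1 during the simulation.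
module Submission where

open import Defs
open import Data.Nat using (ℕ; zero; suc; s≤s; z≤n)
import Data.Nat.Properties as ℕP
open import Data.Integer as ℤ using (ℤ; +_; _⊖_)
import Data.Integer.Properties as ℤP
open import Data.Fin as F using (Fin; toℕ; fromℕ<)
import Data.Fin.Properties as FP
open import Data.Vec using (Vec)
open import Data.Maybe using (Maybe; just; nothing)
open import Data.Product using (Σ; _,_; _×_; proj₁; proj₂)
open import Data.Sum using (_⊎_; inj₁; inj₂)
open import Data.Empty using (⊥-elim)
open import Data.List using (_∷_; [])
open import Data.List.Relation.Unary.Any using (here; there)
open import Data.List.Membership.Propositional using (_∈_)
open import Function using (_∘_)
open import Relation.Nullary using (¬_; yes; no)
open import Relation.Binary.Definitions using (DecidableEquality)
open import Relation.Binary.PropositionalEquality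
open import Relation.Binary.Construct.Closure.ReflexiveTransitive
  using (Star; ε; _◅_; _◅◅_)
open import Function.Bundles using (_⇔_; mk⇔)

module BinaryInteraction
  (S : InteractionSystem) (_≟_ : DecidableEquality (InteractionSystem.K S)) where
  open InteractionSystem S renaming (trans to Local)

  infix 4 _≈_
  _≈_ : GlobalState S → GlobalState S → Set
  q ≈ q' = ∀ l → q l ≡ q' l

  record BinaryStep (q : GlobalState S) (a b : Port) (q' : GlobalState S) : Set where
    field
      step-a : Local (comp a) (q (comp a)) a (q' (comp a))
      step-b : Local (comp b) (q (comp b)) b (q' (comp b))
      idle   : ∀ l → l ≢ comp a → l ≢ comp b → q l ≡ q' l
  open BinaryStep public

  globalStep⇒binaryStep : ∀ {q q' a b} → comp a ≢ comp b →
    GlobalStep S q (a ∷ b ∷ []) q' → BinaryStep q a b q'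
  globalStep⇒binaryStep {q} {q'} {a} {b} a≢b (_ , local) =
    record { step-a = active-a ; step-b = active-b ; idle = passive }
    where
    active-a : Local (comp a) (q (comp a)) a (q' (comp a))
    active-a with local (comp a)
    ... | inj₁ (_ , here refl , _ , t)         = t
    ... | inj₁ (_ , there (here refl) , e , _) = ⊥-elim (a≢b (sym e))
    ... | inj₂ (unused , _)                    = ⊥-elim (unused a (here refl) refl)

    active-b : Local (comp b) (q (comp b)) b (q' (comp b))
    active-b with local (comp b)
    ... | inj₁ (_ , here refl , e , _)         = ⊥-elim (a≢b e)
    ... | inj₁ (_ , there (here refl) , _ , t) = t
    ... | inj₂ (unused , _)                    = ⊥-elim (unused b (there (here refl)) refl)

    passive : ∀ l → l ≢ comp a → l ≢ comp b → q l ≡ q' l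
    passive l l≢a l≢b with local l
    ... | inj₁ (_ , here refl , e , _)         = ⊥-elim (l≢a (sym e))
    ... | inj₁ (_ , there (here refl) , e , _) = ⊥-elim (l≢b (sym e))
    ... | inj₂ (_ , q≡q')                      = q≡q'

  binaryStep⇒globalStep : ∀ {q q' a b} → Int (a ∷ b ∷ []) →
    BinaryStep q a b q' → GlobalStep S q (a ∷ b ∷ []) q'
  binaryStep⇒globalStep {q} {q'} {a} {b} int st = int , local
    where
    local : (l : K) →
      (Σ Port λ c → c ∈ a ∷ b ∷ [] × comp c ≡ l × Local l (q l) c (q' l)) ⊎
      ((∀ c → c ∈ a ∷ b ∷ [] → comp c ≢ l) × q l ≡ q' l)
    local l with l ≟ comp a
    ... | yes refl = inj₁ (a , here refl , refl , step-a st)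
    ... | no l≢a with l ≟ comp b
    ...   | yes refl = inj₁ (b , there (here refl) , refl , step-b st)
    ...   | no l≢b = inj₂ (unused , idle st l l≢a l≢b)
      where
      unused : ∀ c → c ∈ a ∷ b ∷ [] → comp c ≢ l
      unused _ (here refl)         e = l≢a (sym e)
      unused _ (there (here refl)) e = l≢b (sym e)

  binaryStep-respˡ : ∀ {q₁ q₂ q' a b} → q₁ ≈ q₂ →
    BinaryStep q₂ a b q' → BinaryStep q₁ a b q'
  binaryStep-respˡ {a = a} {b} q₁≈q₂ st = record
    { step-a = subst (λ s → Local (comp a) s a _) (sym (q₁≈q₂ (comp a))) (step-a st)
    ; step-b = subst (λ s → Local (comp b) s b _) (sym (q₁≈q₂ (comp b))) (step-b st)
    ; idle   = λ l l≢a l≢b → trans (q₁≈q₂ l) (idle st l l≢a l≢b)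
    }

  binaryStep-deterministic :
    (∀ {l s c t t'} → Local l s c t → Local l s c t' → t ≡ t') →
    ∀ {q q₁ q₂ a b} → BinaryStep q a b q₁ → BinaryStep q a b q₂ → q₁ ≈ q₂
  binaryStep-deterministic local-det {a = a} {b} st₁ st₂ l with l ≟ comp a
  ... | yes refl = local-det (step-a st₁) (step-a st₂)
  ... | no l≢a with l ≟ comp b
  ...   | yes refl = local-det (step-b st₁) (step-b st₂)
  ...   | no l≢b = trans (sym (idle st₁ l l≢a l≢b)) (idle st₂ l l≢a l≢b)

updateTape-same : ∀ M t h γ → updateTape M t h γ h ≡ γ
updateTape-same M t h γ with h ℤ.≟ h
... | yes _   = refl
... | no  h≢h = ⊥-elim (h≢h refl)

updateTape-other : ∀ M t h γ {k} → k ≢ h → updateTape M t h γ k ≡ t k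
updateTape-other M t h γ {k} k≢h with k ℤ.≟ h
... | yes k≡h = ⊥-elim (k≢h k≡h)
... | no  _   = refl

m⊖1≡+n⇒m≡1+n : ∀ m {n} → m ⊖ 1 ≡ + n → m ≡ suc n
m⊖1≡+n⇒m≡1+n (suc m) eq =
  cong suc (ℤP.+-injective (trans (sym (ℤP.⊖-≥ (s≤s z≤n))) eq))

module Simulation (M : DTM) {n : ℕ} (x : Vec (Fin (DTM.nΓ M)) n) where
  open DTM M
  open BinaryInteraction (SysM M x) F._≟_

  Cell : Set
  Cell = Comp M x

  cell : Cell → ℤ
  cell l = + toℕ l

  cell-injective : ∀ {i j} → cell i ≡ cell j → i ≡ j
  cell-injective = FP.toℕ-injective ∘ ℤP.+-injective

  bounded⇒cell : ∀ z → + 0 ℤ.≤ z → z ℤ.≤ + suc n → Σ Cell λ i → z ≡ cell i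
  bounded⇒cell (+ k) _ (ℤ.+≤+ k≤1+n) =
    fromℕ< (s≤s k≤1+n) , cong +_ (sym (FP.toℕ-fromℕ< (s≤s k≤1+n)))

  Adj⇒cell-move : ∀ T {i j} → Adj M x T i j → cell i ℤ.+ moveℤ T ≡ cell j
  Adj⇒cell-move right {i} adj = cong +_ (trans (ℕP.+-comm (toℕ i) 1) adj)
  Adj⇒cell-move left      adj = trans (cong (_⊖ 1) adj) (ℤP.⊖-≥ (s≤s z≤n))

  cell-move⇒Adj : ∀ T {i j} → cell i ℤ.+ moveℤ T ≡ cell j → Adj M x T i j
  cell-move⇒Adj right {i} eq = trans (ℕP.+-comm 1 (toℕ i)) (ℤP.+-injective eq)
  cell-move⇒Adj left  {i} eq = m⊖1≡+n⇒m≡1+n (toℕ i) eq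

  Adj⇒≢ : ∀ T {i j} → Adj M x T i j → i ≢ j
  Adj⇒≢ right adj refl = ℕP.1+n≢n adj
  Adj⇒≢ left  adj refl = ℕP.1+n≢n (sym adj)

  Adj⇒ports : ∀ {p γ i j} → ¬ Halting M p → Adj M x (δmove M p γ) i j →
    InA M x (port i p γ one) × InA M x (port j p γ two)
  Adj⇒ports {p} {γ} {i} {j} running adj with δmove M p γ
  ... | right =
    (running , (λ _ ()) ,
      λ i≡1+n _ → ℕP.<-irrefl (trans (sym adj) (cong suc i≡1+n)) (FP.toℕ<n j)) ,
    (running , (λ j≡0 _ → ℕP.1+n≢0 (trans adj j≡0)) , λ _ ())
  ... | left =
    (running , (λ i≡0 _ → ℕP.1+n≢0 (trans (sym adj) i≡0)) , λ _ ()) ,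
    (running , (λ _ ()) ,
      λ j≡1+n _ → ℕP.<-irrefl (trans adj (cong suc j≡1+n)) (FP.toℕ<n i))

  LTrans-deterministic : ∀ {l s a t t'} →
    LTrans M x l s a t → LTrans M x l s a t' → t ≡ t'
  LTrans-deterministic (tr1 _) (tr1 _) = refl
  LTrans-deterministic (tr2 _) (tr2 _) = refl

  LTrans-one-source : ∀ {l s i p γ t} →
    LTrans M x l s (port i p γ one) t → s ≡ (just p , γ)
  LTrans-one-source (tr1 _) = refl

  control : Config M → Cell → Maybe (Fin nP)
  control c l with cell l ℤ.≟ head c
  ... | yes _ = just (state c)
  ... | no  _ = nothing

  encode : Config M → GlobalState (SysM M x)
  encode c l = control c l , tape c (cell l)

  control-head : ∀ {c l} → head c ≡ cell l → control c l ≡ just (state c)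
  control-head {c} {l} at-l with cell l ℤ.≟ head c
  ... | yes _   = refl
  ... | no  off = ⊥-elim (off (sym at-l))

  control-off : ∀ {c l} → head c ≢ cell l → control c l ≡ nothing
  control-off {c} {l} off with cell l ℤ.≟ head c
  ... | yes at-l = ⊥-elim (off (sym at-l))
  ... | no  _    = refl

  control-just : ∀ {c l p} → control c l ≡ just p → head c ≡ cell l × state c ≡ p
  control-just {c} {l} eq with cell l ℤ.≟ head c
  control-just refl | yes at-l = sym at-l , refl

  encode-off : ∀ {c l} → head c ≢ cell l → encode c l ≡ (nothing , tape c (cell l))
  encode-off {c} {l} off = cong (_, tape c (cell l)) (control-off off)

  encode-binaryStep : ∀ c {p γ i j} → state c ≡ p → tape c (head c) ≡ γ →
    ¬ Halting M p → head c ≡ cell i → Adj M x (δmove M p γ) i j →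
    BinaryStep (encode c) (port i p γ one) (port j p γ two) (encode (next M c))
  encode-binaryStep c {p} {γ} {i} {j} refl refl running at-i adj = record
    { step-a = subst₂ (λ s t → LTrans M x i s (port i p γ one) t)
                 (sym encode-i) (sym encode-next-i) (tr1 (proj₁ ports))
    ; step-b = subst₂ (λ s t → LTrans M x j s (port j p γ two) t)
                 (sym (encode-off (off j≢i))) (sym encode-next-j) (tr2 (proj₂ ports))
    ; idle   = λ l l≢i l≢j →
        trans (encode-off (off l≢i)) (sym (encode-next-off l≢i l≢j))
    }
    where
    w : Fin nΓ
    w = δwrite M p γ

    ports : InA M x (port i p γ one) × InA M x (port j p γ two)
    ports = Adj⇒ports running adj

    j≢i : j ≢ i
    j≢i = Adj⇒≢ _ adj ∘ sym

    at-j : head (next M c) ≡ cell j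
    at-j = trans (cong (ℤ._+ moveℤ (δmove M p γ)) at-i) (Adj⇒cell-move _ adj)

    off : ∀ {l} → l ≢ i → head c ≢ cell l
    off l≢i at-l = l≢i (cell-injective (trans (sym at-l) at-i))

    off-next : ∀ {l} → l ≢ j → head (next M c) ≢ cell l
    off-next l≢j at-l = l≢j (cell-injective (trans (sym at-l) at-j))

    encode-i : encode c i ≡ (just p , γ)
    encode-i = cong₂ _,_ (control-head at-i) (cong (tape c) (sym at-i))

    encode-next-i : encode (next M c) i ≡ (nothing , w)
    encode-next-i = cong₂ _,_ (control-off (off-next (j≢i ∘ sym)))
      (subst (λ h → updateTape M (tape c) (head c) w h ≡ w) at-i
             (updateTape-same M (tape c) (head c) w))

    encode-next-j : encode (next M c) j ≡ (just (δstate M p γ) , tape c (cell j))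
    encode-next-j = cong₂ _,_ (control-head at-j)
      (updateTape-other M (tape c) (head c) w (off j≢i ∘ sym))

    encode-next-off : ∀ {l} → l ≢ i → l ≢ j →
      encode (next M c) l ≡ (nothing , tape c (cell l))
    encode-next-off l≢i l≢j = cong₂ _,_ (control-off (off-next l≢j))
      (updateTape-other M (tape c) (head c) w (off l≢i ∘ sym))

  simulate-step : ∀ {c i j q} → ¬ Halting M (state c) →
    head c ≡ cell i → head (next M c) ≡ cell j → q ≈ encode c →
    GlobalStep' (SysM M x) q (encode (next M c))
  simulate-step {c} {i} {j} running at-i at-j q≈c =
    _ , binaryStep⇒globalStep (state c , tape c (head c) , i , j , running , adj , refl)
          (binaryStep-respˡ q≈c (encode-binaryStep c refl refl running at-i adj))
    where
    T : Move
    T = δmove M (state c) (tape c (head c))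

    adj : Adj M x T i j
    adj = cell-move⇒Adj T (trans (cong (ℤ._+ moveℤ T) (sym at-i)) at-j)

  -- Port (p,γ)¹ᵢ can only fire in local state (p,γ), which in an encoded
  -- configuration pins down the head position, the state and the scanned symbol.
  decode-step : ∀ {c q q'} → q ≈ encode c → GlobalStep' (SysM M x) q q' →
    TMStep M c (next M c) × q' ≈ encode (next M c)
  decode-step {c} {q} {q'} q≈c (_ , step@((p , γ , i , j , running , adj , refl) , _)) =
    (subst (¬_ ∘ Halting M) (sym state≡p) running , refl) ,
    binaryStep-deterministic LTrans-deterministic st
      (binaryStep-respˡ q≈c (encode-binaryStep c state≡p scanned≡γ running at-i adj))
    where
    st : BinaryStep q (port i p γ one) (port j p γ two) q'
    st = globalStep⇒binaryStep (Adj⇒≢ _ adj) step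

    encode-i : encode c i ≡ (just p , γ)
    encode-i = trans (sym (q≈c i)) (LTrans-one-source (step-a st))

    at-i : head c ≡ cell i
    at-i = proj₁ (control-just (cong proj₁ encode-i))

    state≡p : state c ≡ p
    state≡p = proj₂ (control-just (cong proj₁ encode-i))

    scanned≡γ : tape c (head c) ≡ γ
    scanned≡γ = trans (cong (tape c) at-i) (cong proj₂ encode-i)

  Reached : Config M → Set
  Reached = Star (TMStep M) (initConfig M x)

  decode-run : ∀ {c q q'} → Reached c → q ≈ encode c →
    Star (GlobalStep' (SysM M x)) q q' →
    Σ (Config M) λ c' → Reached c' × q' ≈ encode c'
  decode-run reached q≈c ε = _ , reached , q≈c
  decode-run reached q≈c (s ◅ steps) =
    let tm-step , q'≈c' = decode-step q≈c s
    in  decode-run (reached ◅◅ tm-step ◅ ε) q'≈c' steps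

  module _ (bounded : LinearBounded M) (input : IsInput M x) where

    head-cell : ∀ {c} → Reached c → Σ Cell λ i → head c ≡ cell i
    head-cell {c} reached =
      let 0≤h , h≤1+n = bounded n x input c reached in bounded⇒cell (head c) 0≤h h≤1+n

    simulate-run : ∀ {c c' q} → Reached c → Star (TMStep M) c c' → q ≈ encode c →
      Σ (GlobalState (SysM M x)) λ q' → Star (GlobalStep' (SysM M x)) q q' × q' ≈ encode c'
    simulate-run reached ε q≈c = _ , ε , q≈c
    simulate-run reached (tm-step@(running , refl) ◅ run) q≈c =
      let reached' = reached ◅◅ tm-step ◅ ε
          i , at-i = head-cell reached
          j , at-j = head-cell reached'
          q' , steps , q'≈c' = simulate-run reached' run (λ _ → refl)
      in  q' , simulate-step running at-i at-j q≈c ◅ steps , q'≈c'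

  initM≈encode : initM M x ≈ encode (initConfig M x)
  initM≈encode l = cong (_, initTape M x (cell l)) (initCtl≡control (toℕ l) refl)
    where
    initCtl≡control : ∀ k → toℕ l ≡ k → initCtl M x k ≡ control (initConfig M x) l
    initCtl≡control zero          l≡0 =
      sym (control-off λ 1≡l → ℕP.1+n≢0 (trans (ℤP.+-injective 1≡l) l≡0))
    initCtl≡control (suc zero)    l≡1 = sym (control-head (cong +_ (sym l≡1)))
    initCtl≡control (suc (suc k)) l≡k =
      sym (control-off λ 1≡l →
        ℕP.0≢1+n (ℕP.suc-injective (trans (ℤP.+-injective 1≡l) l≡k)))

  AcceptingStateReachable : Set
  AcceptingStateReachable = Σ (GlobalState (SysM M x)) λ q → Reachable (SysM M x) q ×
    (Σ Cell λ i → Σ (Fin nΓ) λ γ → q i ≡ (just pY , γ))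

  accepts⇒acceptingStateReachable : LinearBounded M → IsInput M x →
    Accepts M x → AcceptingStateReachable
  accepts⇒acceptingStateReachable bounded input (c , run , accepting) =
    let q , steps , q≈c = simulate-run bounded input ε run initM≈encode
        i , at-i = head-cell bounded input run
    in  q , steps , i , tape c (head c) ,
        trans (q≈c i) (cong₂ _,_ (trans (control-head at-i) (cong just accepting))
                                 (cong (tape c) (sym at-i)))

  acceptingStateReachable⇒accepts : AcceptingStateReachable → Accepts M x
  acceptingStateReachable⇒accepts (q , steps , i , γ , q-accepting) =
    let c , reached , q≈c = decode-run ε initM≈encode steps
    in  c , reached , proj₂ (control-just (cong proj₁ (trans (sym (q≈c i)) q-accepting)))

mainTheorem1 : (M : DTM) → LinearBounded M →
    (n : ℕ) (x : Vec (Fin (DTM.nΓ M)) n) → IsInput M x →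
    Accepts M x ⇔
      (Σ (GlobalState (SysM M x)) λ q → Reachable (SysM M x) q ×
        (Σ (Comp M x) λ i → Σ (Fin (DTM.nΓ M)) λ γ → q i ≡ (just (DTM.pY M) , γ)))
mainTheorem1 M bounded n x input =
  mk⇔ (accepts⇒acceptingStateReachable bounded input) acceptingStateReachable⇒accepts
  where open Simulation M x
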